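{- Let $k$ be a positive integer and let $h \geq 2$ be an integer. Put $m = 2^{\lfloor \log_2 h \rfloor + 1}k + 1$ and $n = \binom{m}{h}$. Then \[\nu^\wedge(\mathbb{Z}_n, m, h) < \min\left\{n, \binom{m}{h}\right\}\quad\text{and}\quad \nu^\wedge(\mathbb{Z}_n, m, m-h) < \min\left\{n, \binom{m}{m-h}\right\}.\]
   Context: $\mathbb{Z}_n$ denotes the additive cyclic group of order $n$, and $\lfloor x \rfloor$ is the greatest integer $\le x$. For a finite subset $A = \{a_1,\dots,a_m\}$ (with $m$ distinct elements) of an additive abelian group $G$ and an integer $h \ge 0$, the restricted $h$-fold sumset is $h^\wedge A = \{\sum_{i=1}^m \lambda_i a_i : \lambda_i \in \{0,1\},\ \sum_{i=1}^m \lambda_i = h\}$, i.e. the set of sums of $h$ distinct elements of $A$. For positive integers $m,h$, $\nu^\wedge(G,m,h) = \max\{|h^\wedge A| : A \subseteq G,\ |A| = m\}$. -}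

module Defs where

open import Data.Bool using (Bool; true; false; _∧_; T)
open import Data.Nat using (ℕ; zero; suc; _+_; _%_; _⊔_)
open import Data.Nat.Properties using (_≟_)
open import Data.Fin using (Fin; toℕ) renaming (zero to fzero; suc to fsuc)
open import Data.Fin.Subset using (Subset; inside; outside; ∣_∣; _⊆_)
open import Data.Fin.Subset.Properties using (_⊆?_)
open import Data.List using (List; []; _∷_; map; _++_; foldr)
open import Data.Nat.ListAction using (sum)
open import Data.Bool.ListAction using (any)
open import Relation.Nullary using (yes; no)
open import Data.Vec using ([]; _∷_; tabulate)
open import Relation.Nullary.Decidable using (does)

-- Elements of Z_n are represented by Fin n (residues 0,…,n-1);
-- a subset of Z_n is a Data.Fin.Subset n.

allSubsets : (n : ℕ) → List (Subset n)
allSubsets zero    = [] ∷ []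
allSubsets (suc n) = map (outside ∷_) (allSubsets n) ++ map (inside ∷_) (allSubsets n)

elems : {n : ℕ} → Subset n → List (Fin n)
elems []            = []
elems (outside ∷ p) = map fsuc (elems p)
elems (inside ∷ p)  = fzero ∷ map fsuc (elems p)

-- Reduction mod n (only used for n ≥ 1; for n = 0 Fin 0 is empty anyway).
modℕ : ℕ → ℕ → ℕ
modℕ zero    x = x
modℕ (suc n) x = x % suc n

sumZ : {n : ℕ} → Subset n → ℕ
sumZ {n} B = modℕ n (sum (map toℕ (elems B)))

restrictedSumset : (n h : ℕ) → Subset n → Subset n
restrictedSumset n h A = tabulate λ g →
  any (λ B → does (B ⊆? A) ∧ does (∣ B ∣ ≟ h) ∧ does (sumZ B ≟ toℕ g)) (allSubsets n)

-- ν^∧(Z_n, m, h) = max { |h^∧A| : A ⊆ Z_n, |A| = m }.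
νʳ : (n m h : ℕ) → ℕ
νʳ n m h = foldr _⊔_ 0
  (map (λ A → if-size A) (allSubsets n))
  where
  if-size : Subset n → ℕ
  if-size A with ∣ A ∣ ≟ m
  ... | yes _ = ∣ restrictedSumset n h A ∣
  ... | no _  = 0

-- Suppose the restricted h-fold sumset of an m-element set A ⊆ ℤ_n is all of ℤ_n. There are
-- only C(m,h) = n subsets of A of size h, so their sums run through every residue exactly once,
-- and adding them up gives C(m-1,h-1)·ΣA ≡ 0 + 1 + ⋯ + (n-1) (mod n). Multiplied by m, the left
-- side becomes h·C(m,h)·ΣA ≡ 0, whereas m·n(n-1)/2 ≢ 0 (mod n) when n is even and m is odd.
-- Here m = 2^s·k + 1 with s = ⌊log₂ h⌋ + 1 is odd, and n = C(2^s·k, h-1) + C(2^s·k, h) is even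
-- because C(2^s·c, j) is even for 0 < j < 2^s and 2 ≤ h < 2^s. Since C(m, m-h) = n as well,
-- the same argument bounds the (m-h)-fold sumsets.

module Submission where

open import Defs
open import Data.Bool using (T)
open import Data.Bool.Properties using (T-∧; T-≡)
open import Data.Nat
open import Data.Nat.Properties
open import Data.Nat.Combinatorics using (_C_; nC1≡n; nCk+nC[k+1]≡[n+1]C[k+1]; nCk≡nC[n∸k])
open import Data.Nat.DivMod using (_%_; %-distribˡ-+; %-distribˡ-*; m%n%n≡m%n)
open import Data.Nat.Divisibility
  using (_∣_; divides; _∣0; ∣-refl; n∣m*n; m∣m*n; n∣m*n*o; ∣m⇒∣m*n; ∣m∣n⇒∣m+n; ∣m+n∣m⇒∣n; ∣1⇒≡1; *-cancelʳ-∣; m%n≡0⇒n∣m; n∣m⇒m%n≡0)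
open import Data.Nat.Logarithm using (⌊log₂_⌋; ⌊log₂⌋-mono-≤; ⌊log₂[2^n]⌋≡n)
open import Data.Nat.ListAction using (sum)
open import Data.Nat.ListAction.Properties using (sum-++; sum-↭)
open import Data.Nat.Tactic.RingSolver using (solve-∀)
open import Data.Fin using (Fin; toℕ; fromℕ<) renaming (suc to fsuc)
open import Data.Fin.Properties using (toℕ-fromℕ<)
open import Data.Fin.Subset using (Subset; inside; outside; ∣_∣; _⊆_) renaming (_∈_ to _∈ₛ_)
open import Data.Fin.Subset.Properties using (drop-∷-⊆; _⊆?_; ∣p∣≤n; ∣p∣≡n⇒p≡⊤; ∈⊤)
open import Data.List using (List; []; _∷_; [_]; _++_; map; foldr; length; downFrom)
open import Data.List.Properties using (length-++; length-map; map-++; map-∘; length-downFrom; ++-identityʳ)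
open import Data.List.Membership.Propositional using (_∈_)
open import Data.List.Membership.Propositional.Properties using (∈-map⁺; ∈-++⁺ˡ; ∈-++⁺ʳ; ∈-++⁻; ∈-∃++; ∈-downFrom⁻)
open import Data.List.Relation.Unary.Any using (here; satisfied)
open import Data.List.Relation.Unary.Any.Properties using (any⁻)
open import Data.List.Relation.Binary.Permutation.Propositional using (_↭_; ↭-refl; ↭-trans)
open import Data.List.Relation.Binary.Permutation.Propositional.Properties using (∈-resp-↭; ++⁺ˡ; shift; ↭-length)
open import Data.Product using (∃; _,_; _×_)
open import Data.Sum using (_⊎_; inj₁; inj₂)
open import Data.Vec using ([]; _∷_; here)
open import Data.Vec.Properties using ([]=⇒lookup; lookup∘tabulate)
open import Function.Bundles using (Equivalence)
open import Relation.Binary.PropositionalEquality hiding ([_])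
open import Relation.Nullary using (¬_; Dec; yes; no; does; contradiction)

k≤n⇒nCk>0 : ∀ {n k} → k ≤ n → 0 < n C k
k≤n⇒nCk>0 {k = zero}  _         = z<s
k≤n⇒nCk>0 {suc n} {suc k} (s≤s k≤n) =
  subst (0 <_) (nCk+nC[k+1]≡[n+1]C[k+1] n k) (<-≤-trans (k≤n⇒nCk>0 k≤n) (m≤m+n _ _))

[1+k]*[1+n]C[1+k]≡[1+n]*nCk : ∀ n k → suc k * (suc n C suc k) ≡ suc n * (n C k)
[1+k]*[1+n]C[1+k]≡[1+n]*nCk zero    zero    = refl
[1+k]*[1+n]C[1+k]≡[1+n]*nCk zero    (suc k) = *-zeroʳ (suc (suc k))
[1+k]*[1+n]C[1+k]≡[1+n]*nCk (suc n) zero    =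
  trans (*-identityˡ (suc (suc n) C 1)) (trans (nC1≡n (suc (suc n))) (sym (*-identityʳ (suc (suc n)))))
[1+k]*[1+n]C[1+k]≡[1+n]*nCk (suc n) (suc k) = begin
  (2 + k) * ((2 + n) C (2 + k))
    ≡⟨ cong ((2 + k) *_) (nCk+nC[k+1]≡[n+1]C[k+1] (suc n) (suc k)) ⟨
  (2 + k) * (X + (1 + n) C (2 + k))
    ≡⟨ *-distribˡ-+ (2 + k) X ((1 + n) C (2 + k)) ⟩
  X + (1 + k) * X + (2 + k) * ((1 + n) C (2 + k))
    ≡⟨ cong₂ (λ u v → X + u + v) ([1+k]*[1+n]C[1+k]≡[1+n]*nCk n k) ([1+k]*[1+n]C[1+k]≡[1+n]*nCk n (suc k)) ⟩
  X + (1 + n) * (n C k) + (1 + n) * (n C (1 + k))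
    ≡⟨ +-assoc X ((1 + n) * (n C k)) ((1 + n) * (n C (1 + k))) ⟩
  X + ((1 + n) * (n C k) + (1 + n) * (n C (1 + k)))
    ≡⟨ cong (X +_) (*-distribˡ-+ (1 + n) (n C k) (n C (1 + k))) ⟨
  X + (1 + n) * (n C k + n C (1 + k))
    ≡⟨ cong (λ u → X + (1 + n) * u) (nCk+nC[k+1]≡[n+1]C[k+1] n k) ⟩
  (2 + n) * X
    ∎
  where
  open ≡-Reasoning
  X = suc n C suc k

[2+n]C[2+k]≡nCk+2*nC[1+k]+nC[2+k] : ∀ n k → (2 + n) C (2 + k) ≡ n C k + 2 * (n C (1 + k)) + n C (2 + k)
[2+n]C[2+k]≡nCk+2*nC[1+k]+nC[2+k] n k = begin
  (2 + n) C (2 + k)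
    ≡⟨ nCk+nC[k+1]≡[n+1]C[k+1] (suc n) (suc k) ⟨
  (1 + n) C (1 + k) + (1 + n) C (2 + k)
    ≡⟨ cong₂ _+_ (nCk+nC[k+1]≡[n+1]C[k+1] n k) (nCk+nC[k+1]≡[n+1]C[k+1] n (suc k)) ⟨
  (n C k + n C (1 + k)) + (n C (1 + k) + n C (2 + k))
    ≡⟨ regroup (n C k) (n C (1 + k)) (n C (2 + k)) ⟩
  n C k + 2 * (n C (1 + k)) + n C (2 + k)
    ∎
  where
  open ≡-Reasoning
  regroup : ∀ x y z → (x + y) + (y + z) ≡ x + 2 * y + z
  regroup = solve-∀

-- The next two lemmas are (1 + x)^(2a) ≡ (1 + x²)^a (mod 2), read off coefficientwise.

2∣[2a]C[1+2b] : ∀ a b → 2 ∣ 2 * a C suc (2 * b)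
2∣[2a]C[1+2b] zero    b       = _ ∣0
2∣[2a]C[1+2b] (suc a) zero    = subst (2 ∣_) (sym (nC1≡n (2 * suc a))) (m∣m*n (suc a))
2∣[2a]C[1+2b] (suc a) (suc b) =
  subst (2 ∣_) (sym expand)
    (∣m∣n⇒∣m+n (∣m∣n⇒∣m+n (2∣[2a]C[1+2b] a b) (m∣m*n (2 * a C (2 + 2 * b)))) (2∣[2a]C[1+2b] a (suc b)))
  where
  open ≡-Reasoning
  expand : 2 * suc a C suc (2 * suc b)
         ≡ 2 * a C suc (2 * b) + 2 * (2 * a C (2 + 2 * b)) + 2 * a C suc (2 * suc b)
  expand = begin
    2 * suc a C suc (2 * suc b)        ≡⟨ cong₂ (λ x y → x C suc y) (*-suc 2 a) (*-suc 2 b) ⟩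
    (2 + 2 * a) C (2 + suc (2 * b))    ≡⟨ [2+n]C[2+k]≡nCk+2*nC[1+k]+nC[2+k] (2 * a) (suc (2 * b)) ⟩
    2 * a C suc (2 * b) + 2 * (2 * a C (2 + 2 * b)) + 2 * a C (2 + suc (2 * b))
      ≡⟨ cong (λ y → 2 * a C suc (2 * b) + 2 * (2 * a C (2 + 2 * b)) + 2 * a C suc y) (sym (*-suc 2 b)) ⟩
    2 * a C suc (2 * b) + 2 * (2 * a C (2 + 2 * b)) + 2 * a C suc (2 * suc b) ∎

2∣[2a]C[2b]+aCb : ∀ a b → 2 ∣ 2 * a C (2 * b) + a C b
2∣[2a]C[2b]+aCb a       zero    = ∣-refl
2∣[2a]C[2b]+aCb zero    (suc b) = 2 ∣0
2∣[2a]C[2b]+aCb (suc a) (suc b) =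
  subst (2 ∣_) (sym expand)
    (∣m∣n⇒∣m+n (∣m∣n⇒∣m+n (2∣[2a]C[2b]+aCb a b) (2∣[2a]C[2b]+aCb a (suc b))) (m∣m*n (2 * a C suc (2 * b))))
  where
  open ≡-Reasoning
  regroup : ∀ p q r s t → (p + 2 * q + r) + (s + t) ≡ (p + s) + (r + t) + 2 * q
  regroup = solve-∀
  expand : 2 * suc a C (2 * suc b) + suc a C suc b
         ≡ (2 * a C (2 * b) + a C b) + (2 * a C (2 * suc b) + a C suc b) + 2 * (2 * a C suc (2 * b))
  expand = begin
    2 * suc a C (2 * suc b) + suc a C suc b
      ≡⟨ cong₂ (λ x y → x C y + suc a C suc b) (*-suc 2 a) (*-suc 2 b) ⟩
    (2 + 2 * a) C (2 + 2 * b) + suc a C suc b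
      ≡⟨ cong₂ _+_ ([2+n]C[2+k]≡nCk+2*nC[1+k]+nC[2+k] (2 * a) (2 * b)) (sym (nCk+nC[k+1]≡[n+1]C[k+1] a b)) ⟩
    (2 * a C (2 * b) + 2 * (2 * a C suc (2 * b)) + 2 * a C (2 + 2 * b)) + (a C b + a C suc b)
      ≡⟨ regroup (2 * a C (2 * b)) (2 * a C suc (2 * b)) (2 * a C (2 + 2 * b)) (a C b) (a C suc b) ⟩
    (2 * a C (2 * b) + a C b) + (2 * a C (2 + 2 * b) + a C suc b) + 2 * (2 * a C suc (2 * b))
      ≡⟨ cong (λ y → (2 * a C (2 * b) + a C b) + (2 * a C y + a C suc b) + 2 * (2 * a C suc (2 * b))) (sym (*-suc 2 b)) ⟩
    (2 * a C (2 * b) + a C b) + (2 * a C (2 * suc b) + a C suc b) + 2 * (2 * a C suc (2 * b)) ∎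

even-or-odd : ∀ n → ∃ λ k → n ≡ 2 * k ⊎ n ≡ suc (2 * k)
even-or-odd zero = 0 , inj₁ refl
even-or-odd (suc n) with even-or-odd n
... | k , inj₁ n≡2k = k , inj₂ (cong suc n≡2k)
... | k , inj₂ n≡1+2k = suc k , inj₁ (trans (cong suc n≡1+2k) (sym (*-suc 2 k)))

2∣[2^s*c]Cj : ∀ s c {j} → 0 < j → j < 2 ^ s → 2 ∣ (2 ^ s * c) C j
2∣[2^s*c]Cj zero    c (s≤s z≤n) (s≤s ())
2∣[2^s*c]Cj (suc s) c {j} 0<j j<2^[1+s] rewrite *-assoc 2 (2 ^ s) c with even-or-odd j
... | zero  , inj₁ refl = contradiction 0<j n≮0
... | suc b , inj₁ refl =
  ∣m+n∣m⇒∣n (subst (2 ∣_) (+-comm _ ((2 ^ s * c) C suc b)) (2∣[2a]C[2b]+aCb (2 ^ s * c) (suc b)))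
            (2∣[2^s*c]Cj s c z<s (*-cancelˡ-< 2 (suc b) (2 ^ s) j<2^[1+s]))
... | b     , inj₂ refl = 2∣[2a]C[1+2b] (2 ^ s * c) b

2∣[2^s*c+1]Ch : ∀ s c {h} → 2 ≤ h → h < 2 ^ s → 2 ∣ (2 ^ s * c + 1) C h
2∣[2^s*c+1]Ch s c {suc (suc h)} (s≤s (s≤s _)) h<2^s =
  subst (2 ∣_) pascal (∣m∣n⇒∣m+n (2∣[2^s*c]Cj s c z<s (<-trans (n<1+n (suc h)) h<2^s)) (2∣[2^s*c]Cj s c z<s h<2^s))
  where
  pascal : (2 ^ s * c) C suc h + (2 ^ s * c) C (2 + h) ≡ (2 ^ s * c + 1) C (2 + h)
  pascal = trans (nCk+nC[k+1]≡[n+1]C[k+1] (2 ^ s * c) (suc h)) (cong (_C (2 + h)) (+-comm 1 (2 ^ s * c)))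

n<2^[⌊log₂n⌋+1] : ∀ n → n < 2 ^ (⌊log₂ n ⌋ + 1)
n<2^[⌊log₂n⌋+1] n with n <? 2 ^ (⌊log₂ n ⌋ + 1)
... | yes n<2^[t+1] = n<2^[t+1]
... | no  n≮2^[t+1] = contradiction (m<m+n ⌊log₂ n ⌋ z<s)
  (≤⇒≯ (subst (_≤ ⌊log₂ n ⌋) (⌊log₂[2^n]⌋≡n (⌊log₂ n ⌋ + 1)) (⌊log₂⌋-mono-≤ (≮⇒≥ n≮2^[t+1]))))

module _ {X : Set} where

  choose : ℕ → List X → List (List X)
  choose zero    _        = [ [] ]
  choose (suc h) []       = []
  choose (suc h) (x ∷ xs) = map (x ∷_) (choose h xs) ++ choose (suc h) xs

  length-choose : ∀ h xs → length (choose h xs) ≡ length xs C h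
  length-choose zero    xs       = refl
  length-choose (suc h) []       = refl
  length-choose (suc h) (x ∷ xs) = begin
    length (map (x ∷_) (choose h xs) ++ choose (suc h) xs)
      ≡⟨ length-++ (map (x ∷_) (choose h xs)) ⟩
    length (map (x ∷_) (choose h xs)) + length (choose (suc h) xs)
      ≡⟨ cong₂ _+_ (trans (length-map (x ∷_) (choose h xs)) (length-choose h xs)) (length-choose (suc h) xs) ⟩
    length xs C h + length xs C suc h
      ≡⟨ nCk+nC[k+1]≡[n+1]C[k+1] (length xs) h ⟩
    suc (length xs) C suc h
      ∎
    where open ≡-Reasoning

  ∈-choose-∷ : ∀ x h xs {ys : List X} → ys ∈ choose h xs → x ∷ ys ∈ choose (suc h) (x ∷ xs)
  ∈-choose-∷ x h xs ys∈ = ∈-++⁺ˡ (∈-map⁺ (x ∷_) ys∈)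

  ∈-choose-∷ʳ : ∀ x h xs {ys : List X} → ys ∈ choose h xs → ys ∈ choose h (x ∷ xs)
  ∈-choose-∷ʳ x zero    xs ys∈ = ys∈
  ∈-choose-∷ʳ x (suc h) xs ys∈ = ∈-++⁺ʳ (map (x ∷_) (choose h xs)) ys∈

choose-map : ∀ {X Y : Set} (f : X → Y) h xs → choose h (map f xs) ≡ map (map f) (choose h xs)
choose-map f zero    xs       = refl
choose-map f (suc h) []       = refl
choose-map f (suc h) (x ∷ xs) = begin
  map (f x ∷_) (choose h (map f xs)) ++ choose (suc h) (map f xs)
    ≡⟨ cong₂ (λ u v → map (f x ∷_) u ++ v) (choose-map f h xs) (choose-map f (suc h) xs) ⟩
  map (f x ∷_) (map (map f) (choose h xs)) ++ map (map f) (choose (suc h) xs)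
    ≡⟨ cong (_++ map (map f) (choose (suc h) xs)) (trans (sym (map-∘ (choose h xs))) (map-∘ (choose h xs))) ⟩
  map (map f) (map (x ∷_) (choose h xs)) ++ map (map f) (choose (suc h) xs)
    ≡⟨ sym (map-++ (map f) (map (x ∷_) (choose h xs)) (choose (suc h) xs)) ⟩
  map (map f) (map (x ∷_) (choose h xs) ++ choose (suc h) xs) ∎
  where open ≡-Reasoning

∈-choose-map : ∀ {X Y : Set} (f : X → Y) h xs {ys} → ys ∈ choose h xs → map f ys ∈ choose h (map f xs)
∈-choose-map f h xs ys∈ = subst (map f _ ∈_) (sym (choose-map f h xs)) (∈-map⁺ (map f) ys∈)

sum-map-sum-map-∷ : ∀ x (xss : List (List ℕ)) →
                    sum (map sum (map (x ∷_) xss)) ≡ length xss * x + sum (map sum xss)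
sum-map-sum-map-∷ x []         = refl
sum-map-sum-map-∷ x (xs ∷ xss) =
  trans (cong (x + sum xs +_) (sum-map-sum-map-∷ x xss)) (regroup x (sum xs) (length xss) (sum (map sum xss)))
  where
  regroup : ∀ x s l t → (x + s) + (l * x + t) ≡ (x + l * x) + (s + t)
  regroup = solve-∀

sum-map-sum-choose : ∀ h xs → sum (map sum (choose (suc h) xs)) ≡ (pred (length xs) C h) * sum xs
sum-map-sum-choose h       []       = sym (*-zeroʳ (0 C h))
sum-map-sum-choose zero    (x ∷ xs) = begin
  sum (map sum (map (x ∷_) [ [] ] ++ choose 1 xs)) ≡⟨ cong (x + 0 +_) (sum-map-sum-choose zero xs) ⟩
  x + 0 + (pred (length xs) C 0) * sum xs           ≡⟨ cong (_+ 1 * sum xs) (+-identityʳ x) ⟩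
  x + 1 * sum xs                                    ≡⟨ cong (x +_) (*-identityˡ (sum xs)) ⟩
  x + sum xs                                        ≡⟨ *-identityˡ (x + sum xs) ⟨
  1 * (x + sum xs)                                  ∎
  where open ≡-Reasoning
sum-map-sum-choose (suc h) (x ∷ [])          = refl
sum-map-sum-choose (suc h) (x ∷ xs@(_ ∷ ys)) = begin
  sum (map sum (map (x ∷_) (choose (suc h) xs) ++ choose (2 + h) xs))
    ≡⟨ cong sum (map-++ sum (map (x ∷_) (choose (suc h) xs)) (choose (2 + h) xs)) ⟩
  sum (map sum (map (x ∷_) (choose (suc h) xs)) ++ map sum (choose (2 + h) xs))
    ≡⟨ sum-++ (map sum (map (x ∷_) (choose (suc h) xs))) (map sum (choose (2 + h) xs)) ⟩
  sum (map sum (map (x ∷_) (choose (suc h) xs))) + sum (map sum (choose (2 + h) xs))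
    ≡⟨ cong (_+ sum (map sum (choose (2 + h) xs))) (sum-map-sum-map-∷ x (choose (suc h) xs)) ⟩
  length (choose (suc h) xs) * x + sum (map sum (choose (suc h) xs)) + sum (map sum (choose (2 + h) xs))
    ≡⟨ cong₂ (λ u v → u * x + v + sum (map sum (choose (2 + h) xs)))
             (length-choose (suc h) xs) (sum-map-sum-choose h xs) ⟩
  (suc l C suc h) * x + (l C h) * S + sum (map sum (choose (2 + h) xs))
    ≡⟨ cong ((suc l C suc h) * x + (l C h) * S +_) (sum-map-sum-choose (suc h) xs) ⟩
  (suc l C suc h) * x + (l C h) * S + (l C suc h) * S
    ≡⟨ cong (λ u → u * x + (l C h) * S + (l C suc h) * S) (nCk+nC[k+1]≡[n+1]C[k+1] l h) ⟨
  (l C h + l C suc h) * x + (l C h) * S + (l C suc h) * S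
    ≡⟨ regroup (l C h) (l C suc h) x S ⟩
  (l C h + l C suc h) * (x + S)
    ≡⟨ cong (_* (x + S)) (nCk+nC[k+1]≡[n+1]C[k+1] l h) ⟩
  (suc l C suc h) * (x + S) ∎
  where
  open ≡-Reasoning
  l = length ys
  S = sum xs
  regroup : ∀ p q x s → (p + q) * x + p * s + q * s ≡ (p + q) * (x + s)
  regroup = solve-∀

length*sum-map-sum-choose : ∀ h xs →
  length xs * sum (map sum (choose (suc h) xs)) ≡ suc h * (length xs C suc h) * sum xs
length*sum-map-sum-choose h []       = sym (*-zeroʳ (suc h * 0))
length*sum-map-sum-choose h (x ∷ xs) = begin
  suc l * sum (map sum (choose (suc h) (x ∷ xs)))  ≡⟨ cong (suc l *_) (sum-map-sum-choose h (x ∷ xs)) ⟩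
  suc l * ((l C h) * S)                            ≡⟨ *-assoc (suc l) (l C h) S ⟨
  suc l * (l C h) * S                              ≡⟨ cong (_* S) ([1+k]*[1+n]C[1+k]≡[1+n]*nCk l h) ⟨
  suc h * (suc l C suc h) * S                      ∎
  where
  open ≡-Reasoning
  l = length xs
  S = x + sum xs

sum-downFrom : ∀ n → 2 * sum (downFrom n) + n ≡ n * n
sum-downFrom zero    = refl
sum-downFrom (suc n) = begin
  2 * (n + sum (downFrom n)) + suc n     ≡⟨ regroup n (sum (downFrom n)) ⟩
  (2 * sum (downFrom n) + n) + 2 * n + 1 ≡⟨ cong (λ u → u + 2 * n + 1) (sum-downFrom n) ⟩
  n * n + 2 * n + 1                      ≡⟨ square n ⟩
  suc n * suc n                          ∎
  where
  open ≡-Reasoning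
  regroup : ∀ n s → 2 * (n + s) + suc n ≡ (2 * s + n) + 2 * n + 1
  regroup = solve-∀
  square : ∀ n → n * n + 2 * n + 1 ≡ suc n * suc n
  square = solve-∀

sum-map-% : ∀ n .{{_ : NonZero n}} xs → sum (map (_% n) xs) % n ≡ sum xs % n
sum-map-% n []       = refl
sum-map-% n (x ∷ xs) = begin
  (x % n + sum (map (_% n) xs)) % n          ≡⟨ %-distribˡ-+ (x % n) (sum (map (_% n) xs)) n ⟩
  (x % n % n + sum (map (_% n) xs) % n) % n  ≡⟨ cong₂ (λ u v → (u + v) % n) (m%n%n≡m%n x n) (sum-map-% n xs) ⟩
  (x % n + sum xs % n) % n                   ≡⟨ %-distribˡ-+ x (sum xs) n ⟨
  (x + sum xs) % n                           ∎
  where open ≡-Reasoning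

covering-↭-downFrom-++ : ∀ n {ys : List ℕ} → (∀ {g} → g < n → g ∈ ys) → ∃ λ ws → ys ↭ downFrom n ++ ws
covering-↭-downFrom-++ zero    _       = _ , ↭-refl
covering-↭-downFrom-++ (suc n) covers with covering-↭-downFrom-++ n (λ g<n → covers (m<n⇒m<1+n g<n))
... | ws , ys↭ with ∈-++⁻ (downFrom n) (∈-resp-↭ ys↭ (covers (n<1+n n)))
...   | inj₁ n∈downFrom = contradiction (∈-downFrom⁻ n∈downFrom) (<-irrefl refl)
...   | inj₂ n∈ws with ∈-∃++ n∈ws
...     | as , bs , refl =
  as ++ bs , ↭-trans ys↭ (↭-trans (++⁺ˡ (downFrom n) (shift n as bs)) (shift n (downFrom n) (as ++ bs)))

covering-↭-downFrom : ∀ n {ys : List ℕ} → length ys ≡ n → (∀ {g} → g < n → g ∈ ys) → ys ↭ downFrom n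
covering-↭-downFrom n {ys} |ys|≡n covers with covering-↭-downFrom-++ n covers
... | [] , ys↭ = subst (ys ↭_) (++-identityʳ (downFrom n)) ys↭
... | w ∷ ws , ys↭ = contradiction (begin
  n + length (w ∷ ws)                   ≡⟨ cong (_+ length (w ∷ ws)) (length-downFrom n) ⟨
  length (downFrom n) + length (w ∷ ws) ≡⟨ length-++ (downFrom n) ⟨
  length (downFrom n ++ w ∷ ws)         ≡⟨ ↭-length ys↭ ⟨
  length ys                             ≡⟨ |ys|≡n ⟩
  n                                     ∎) (m+1+n≢m n)
  where open ≡-Reasoning

∣*-resp-% : ∀ {d} .{{_ : NonZero d}} m {a b} → a % d ≡ b % d → d ∣ m * a → d ∣ m * b
∣*-resp-% {d} m {a} {b} a≡b d∣m*a = m%n≡0⇒n∣m (m * b) d (begin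
  m * b % d              ≡⟨ %-distribˡ-* m b d ⟩
  (m % d) * (b % d) % d  ≡⟨ cong (λ r → (m % d) * r % d) a≡b ⟨
  (m % d) * (a % d) % d  ≡⟨ %-distribˡ-* m a d ⟨
  m * a % d              ≡⟨ n∣m⇒m%n≡0 (m * a) d d∣m*a ⟩
  0                      ∎)
  where open ≡-Reasoning

∤odd*sum-downFrom : ∀ {m n} → ¬ 2 ∣ m → 2 ∣ n → 0 < n → ¬ n ∣ m * sum (downFrom n)
∤odd*sum-downFrom     m-odd (divides zero      refl) ()
∤odd*sum-downFrom {m} m-odd (divides r@(suc _) refl) _ n∣m*U =
  m-odd (*-cancelʳ-∣ r (subst (_∣ m * r) (*-comm r 2) n∣m*r))
  where
  open ≡-Reasoning
  n = r * 2
  U = sum (downFrom n)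
  U+r≡r*n : U + r ≡ r * n
  U+r≡r*n = *-cancelˡ-≡ (U + r) (r * n) 2 (begin
    2 * (U + r)  ≡⟨ double-sum U r ⟩
    2 * U + n    ≡⟨ sum-downFrom n ⟩
    n * n        ≡⟨ *-assoc r 2 n ⟩
    r * (2 * n)  ≡⟨ x*[2*y]≡2*[x*y] r n ⟩
    2 * (r * n)  ∎)
    where
    double-sum : ∀ u r → 2 * (u + r) ≡ 2 * u + r * 2
    double-sum = solve-∀
    x*[2*y]≡2*[x*y] : ∀ x y → x * (2 * y) ≡ 2 * (x * y)
    x*[2*y]≡2*[x*y] = solve-∀
  n∣m*[U+r] : n ∣ m * (U + r)
  n∣m*[U+r] = subst (n ∣_) (trans (*-assoc m r n) (cong (m *_) (sym U+r≡r*n))) (n∣m*n (m * r))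
  n∣m*r : n ∣ m * r
  n∣m*r = ∣m+n∣m⇒∣n (subst (n ∣_) (*-distribˡ-+ m U r) n∣m*[U+r]) n∣m*U

residues : ∀ {n} → Subset n → List ℕ
residues []            = []
residues (outside ∷ p) = map suc (residues p)
residues (inside ∷ p)  = 0 ∷ map suc (residues p)

map-toℕ-map-fsuc : ∀ {n} (xs : List (Fin n)) → map toℕ (map fsuc xs) ≡ map suc (map toℕ xs)
map-toℕ-map-fsuc xs = trans (sym (map-∘ xs)) (map-∘ xs)

map-toℕ-elems≡residues : ∀ {n} (p : Subset n) → map toℕ (elems p) ≡ residues p
map-toℕ-elems≡residues []            = refl
map-toℕ-elems≡residues (outside ∷ p) =
  trans (map-toℕ-map-fsuc (elems p)) (cong (map suc) (map-toℕ-elems≡residues p))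
map-toℕ-elems≡residues (inside ∷ p)  =
  cong (0 ∷_) (trans (map-toℕ-map-fsuc (elems p)) (cong (map suc) (map-toℕ-elems≡residues p)))

length-residues : ∀ {n} (p : Subset n) → length (residues p) ≡ ∣ p ∣
length-residues []            = refl
length-residues (outside ∷ p) = trans (length-map suc (residues p)) (length-residues p)
length-residues (inside ∷ p)  = cong suc (trans (length-map suc (residues p)) (length-residues p))

residues-∈-choose : ∀ {n} {p q : Subset n} → p ⊆ q → residues p ∈ choose ∣ p ∣ (residues q)
residues-∈-choose {p = []}          {[]}          _   = here refl
residues-∈-choose {p = inside ∷ p}  {outside ∷ q} p⊆q with p⊆q here
... | ()
residues-∈-choose {p = outside ∷ p} {outside ∷ q} p⊆q =
  ∈-choose-map suc ∣ p ∣ (residues q) (residues-∈-choose (drop-∷-⊆ p⊆q))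
residues-∈-choose {p = outside ∷ p} {inside ∷ q}  p⊆q =
  ∈-choose-∷ʳ 0 ∣ p ∣ _ (∈-choose-map suc ∣ p ∣ (residues q) (residues-∈-choose (drop-∷-⊆ p⊆q)))
residues-∈-choose {p = inside ∷ p}  {inside ∷ q}  p⊆q =
  ∈-choose-∷ 0 ∣ p ∣ _ (∈-choose-map suc ∣ p ∣ (residues q) (residues-∈-choose (drop-∷-⊆ p⊆q)))

T-does⇒ : ∀ {P : Set} (P? : Dec P) → T (does P?) → P
T-does⇒ (yes p) _ = p

∈-restrictedSumset⁻ : ∀ {n h A g} → g ∈ₛ restrictedSumset n h A →
                      ∃ λ B → B ⊆ A × ∣ B ∣ ≡ h × sumZ B ≡ toℕ g
∈-restrictedSumset⁻ {n} {h} {A} {g} g∈ with satisfied (any⁻ _ (allSubsets n) (Equivalence.from T-≡ g-hit))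
  where
  g-hit = trans (sym (lookup∘tabulate _ g)) ([]=⇒lookup g∈)
... | B , B-fits with Equivalence.to (T-∧ {does (B ⊆? A)}) B-fits
...   | B⊆A , rest with Equivalence.to (T-∧ {does (∣ B ∣ ≟ h)}) rest
...     | |B|≡h , sumB≡g =
  B , T-does⇒ (B ⊆? A) B⊆A , T-does⇒ (∣ B ∣ ≟ h) |B|≡h , T-does⇒ (sumZ B ≟ toℕ g) sumB≡g

¬full-restrictedSumset : ∀ {n m h} (A : Subset n) → ∣ A ∣ ≡ m → ¬ 2 ∣ m → 2 ∣ n → 0 < n →
                         m C suc h ≡ n → ¬ (∀ g → g ∈ₛ restrictedSumset n (suc h) A)
¬full-restrictedSumset {n@(suc _)} {m} {h} A |A|≡m m-odd 2∣n 0<n mCh≡n full =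
  ∤odd*sum-downFrom m-odd 2∣n 0<n (∣*-resp-% m total≡sum-downFrom n∣m*total)
  where
  open ≡-Reasoning
  xs = residues A
  sums = map sum (choose (suc h) xs)

  |xs|≡m : length xs ≡ m
  |xs|≡m = trans (length-residues A) |A|≡m

  covers : ∀ {g} → g < n → g ∈ map (_% n) sums
  covers {g} g<n with ∈-restrictedSumset⁻ (full (fromℕ< g<n))
  ... | B , B⊆A , |B|≡h , sumB≡g =
    subst (_∈ map (_% n) sums) sum%n≡g (∈-map⁺ (_% n) (∈-map⁺ sum B∈))
    where
    B∈ : residues B ∈ choose (suc h) xs
    B∈ = subst (λ k → residues B ∈ choose k xs) |B|≡h (residues-∈-choose B⊆A)
    sum%n≡g : sum (residues B) % n ≡ g
    sum%n≡g = trans (cong (λ ys → sum ys % n) (sym (map-toℕ-elems≡residues B))) (trans sumB≡g (toℕ-fromℕ< g<n))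

  length-residue-sums : length (map (_% n) sums) ≡ n
  length-residue-sums = begin
    length (map (_% n) sums)     ≡⟨ length-map (_% n) sums ⟩
    length sums                  ≡⟨ length-map sum (choose (suc h) xs) ⟩
    length (choose (suc h) xs)   ≡⟨ length-choose (suc h) xs ⟩
    length xs C suc h            ≡⟨ cong (_C suc h) |xs|≡m ⟩
    m C suc h                    ≡⟨ mCh≡n ⟩
    n                            ∎

  total≡sum-downFrom : sum sums % n ≡ sum (downFrom n) % n
  total≡sum-downFrom = trans (sym (sum-map-% n sums))
    (cong (_% n) (sum-↭ (covering-↭-downFrom n length-residue-sums covers)))

  n∣m*total : n ∣ m * sum sums
  n∣m*total = subst (n ∣_) (sym m*total≡) (n∣m*n*o (suc h) (sum xs))
    where
    m*total≡ : m * sum sums ≡ suc h * n * sum xs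
    m*total≡ = begin
      m * sum sums                          ≡⟨ cong (_* sum sums) |xs|≡m ⟨
      length xs * sum sums                  ≡⟨ length*sum-map-sum-choose h xs ⟩
      suc h * (length xs C suc h) * sum xs  ≡⟨ cong (λ k → suc h * k * sum xs) (trans (cong (_C suc h) |xs|≡m) mCh≡n) ⟩
      suc h * n * sum xs                    ∎

∣p∣<n : ∀ {n} (p : Subset n) → ¬ (∀ g → g ∈ₛ p) → ∣ p ∣ < n
∣p∣<n p p≢⊤ = ≤∧≢⇒< (∣p∣≤n p) (λ |p|≡n → p≢⊤ (λ g → subst (g ∈ₛ_) (sym (∣p∣≡n⇒p≡⊤ |p|≡n)) ∈⊤))

foldr-⊔-attained : ∀ {X : Set} {v} (f : X → ℕ) xs → v ≡ foldr _⊔_ 0 (map f xs) → v ≡ 0 ⊎ ∃ λ x → v ≡ f x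
foldr-⊔-attained f []       v≡ = inj₁ v≡
foldr-⊔-attained f (x ∷ xs) refl with ⊔-sel (f x) (foldr _⊔_ 0 (map f xs))
... | inj₁ v≡fx = inj₂ (x , v≡fx)
... | inj₂ v≡max with foldr-⊔-attained f xs refl
...   | inj₁ max≡0       = inj₁ (trans v≡max max≡0)
...   | inj₂ (y , max≡fy) = inj₂ (y , trans v≡max max≡fy)

-- The maximum v is passed through an equation so that, at v = νʳ n m h with refl, Agda unfolds
-- νʳ and infers f, the summand that is local to the definition of νʳ and cannot be named here.
νʳ<n : ∀ {n m h} → ¬ 2 ∣ m → 2 ∣ n → 0 < n → 0 < h → m C h ≡ n → νʳ n m h < n
νʳ<n {n} {m} {suc h} m-odd 2∣n 0<n _ mCh≡n
  with foldr-⊔-attained {v = νʳ n m (suc h)} _ (allSubsets n) refl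
... | inj₁ νʳ≡0 = subst (_< n) (sym νʳ≡0) 0<n
... | inj₂ (A , νʳ≡) with ∣ A ∣ ≟ m
...   | yes |A|≡m = subst (_< n) (sym νʳ≡) (∣p∣<n _ (¬full-restrictedSumset A |A|≡m m-odd 2∣n 0<n mCh≡n))
...   | no  _     = subst (_< n) (sym νʳ≡) 0<n

¬2∣2^[t+1]*k+1 : ∀ t k → ¬ 2 ∣ 2 ^ (t + 1) * k + 1
¬2∣2^[t+1]*k+1 t k 2∣m with ∣1⇒≡1 (∣m+n∣m⇒∣n 2∣m (∣m⇒∣m*n k 2∣2^[t+1]))
  where
  2∣2^[t+1] : 2 ∣ 2 ^ (t + 1)
  2∣2^[t+1] = subst (2 ∣_) (cong (2 ^_) (+-comm 1 t)) (m∣m*n (2 ^ t))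
... | ()

theorem1p6 : (k h : ℕ) → 1 ≤ k → 2 ≤ h →
    let m = 2 ^ (⌊log₂ h ⌋ + 1) * k + 1
        n = m C h
    in (νʳ n m h < n ⊓ (m C h)) × (νʳ n m (m ∸ h) < n ⊓ (m C (m ∸ h)))
theorem1p6 k h 1≤k 2≤h =
  subst (νʳ n m h <_) (sym (⊓-idem n)) (νʳ<n m-odd n-even 0<n (<-trans z<s 2≤h) refl) ,
  subst (νʳ n m (m ∸ h) <_) (sym (trans (cong (n ⊓_) mC[m∸h]≡n) (⊓-idem n)))
    (νʳ<n m-odd n-even 0<n (m<n⇒0<n∸m h<m) mC[m∸h]≡n)
  where
  t = ⌊log₂ h ⌋
  m = 2 ^ (t + 1) * k + 1
  n = m C h
  h<2^[t+1] : h < 2 ^ (t + 1)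
  h<2^[t+1] = n<2^[⌊log₂n⌋+1] h
  h<m : h < m
  h<m = begin-strict
    h                  <⟨ h<2^[t+1] ⟩
    2 ^ (t + 1)        ≡⟨ *-identityʳ (2 ^ (t + 1)) ⟨
    2 ^ (t + 1) * 1    ≤⟨ *-monoʳ-≤ (2 ^ (t + 1)) 1≤k ⟩
    2 ^ (t + 1) * k    ≤⟨ m≤m+n (2 ^ (t + 1) * k) 1 ⟩
    m                  ∎
    where open ≤-Reasoning
  m-odd : ¬ 2 ∣ m
  m-odd = ¬2∣2^[t+1]*k+1 t k
  n-even : 2 ∣ n
  n-even = 2∣[2^s*c+1]Ch (t + 1) k 2≤h h<2^[t+1]
  0<n : 0 < n
  0<n = k≤n⇒nCk>0 (<⇒≤ h<m)
  mC[m∸h]≡n : m C (m ∸ h) ≡ n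
  mC[m∸h]≡n = sym (nCk≡nC[n∸k] (<⇒≤ h<m))
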